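{- Any deterministic algorithm that solves the rendezvous task on all labeled infinite lines, where the two agents start at adjacent nodes, uses $\Omega(\log^*\ell)$ rounds in the worst case, where $\ell$ is the larger label of the two starting nodes. More precisely, there is a constant $c>0$ such that for every such algorithm there exists a labeled infinite line and a pair of adjacent starting nodes (with both agents starting in the same round) for which the agents do not meet within $c\log^*\ell$ rounds. This holds even though the agents know that the initial distance is $1$ and they start simultaneously.
   Context: Model: The infinite line is the infinite connected graph in which every node has degree 2. Each node has a distinct positive integer label (the labeling is arbitrary), and at each node the two incident edges have port numbers $0$ and $1$. Two mobile agents execute the same deterministic algorithm (agents are anonymous, unbounded memory), starting at two distinct nodes; rounds are synchronous. In each round an agent either stays idle or moves to an adjacent node. An agent located at a node sees its label and ports, and after moving knows the port by which it arrived; labels of nodes become known to an agent only when visited. Agents crossing the same edge in opposite directions do not notice this. Rendezvous means both agents are at the same node in the same round; its time is counted in rounds from the start. $\log^*$ is the base-2 iterated logarithm: $\log^*(n)=0$ if $n\le1$, else $1+\log^*(\log_2 n)$. -}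

module Defs where

open import Data.Nat using (ℕ; zero; suc; _≤_; _≤ᵇ_; _⊔_)
open import Data.Nat.Logarithm using (⌈log₂_⌉)
open import Data.Integer using (ℤ) renaming (_+_ to _+ℤ_; _-_ to _-ℤ_)
open import Data.Bool using (Bool; true; false; not; if_then_else_; _xor_)
open import Data.Maybe using (Maybe; just; nothing)
open import Data.List using (List; []; _∷_)
open import Data.Product using (_×_; _,_; proj₁)
open import Data.Sum using (_⊎_)
open import Relation.Binary.PropositionalEquality using (_≡_)

-- For integer n the real-valued log* satisfies log*(n) = 1 + log*(⌈log₂ n⌉)
-- (the thresholds of log* are the integers 1,2,4,16,...), so we iterate ⌈log₂⌉.
-- Fuel n suffices since ⌈log₂ n⌉ < n for n ≥ 2.
logStarAux : ℕ → ℕ → ℕ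
logStarAux zero    n = 0
logStarAux (suc f) n = if n ≤ᵇ 1 then 0 else suc (logStarAux f ⌈log₂ n ⌉)

logStar : ℕ → ℕ
logStar n = logStarAux n n

-- A labeled infinite line: nodes are the integers, node v adjacent to v±1.
-- Labels are distinct positive integers; at each node, `rightPort v` is the
-- port number (false = 0, true = 1) of the edge towards v+1; the other port
-- leads to v-1. Leaving by port p moves right iff p = rightPort v
-- (i.e. p xor rightPort v = false).
record Line : Set where
  field
    label     : ℤ → ℕ
    label-pos : ∀ v → 1 ≤ label v
    label-inj : ∀ u v → label u ≡ label v → u ≡ v
    rightPort : ℤ → Bool
open Line public

-- What an agent perceives in a round: label of the current node, and the port
-- by which it arrived (nothing if it did not move / initial round).
Obs : Set
Obs = ℕ × Maybe Bool

data Action : Set where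
  idle : Action
  go   : Bool → Action

-- A deterministic algorithm (unbounded memory): the next action is an arbitrary
-- function of the whole observation history (most recent observation first).
Algorithm : Set
Algorithm = List Obs → Action

step : Line → Algorithm → ℤ × List Obs → ℤ × List Obs
step L A (v , h) with A h
... | idle = v , ((label L v , nothing) ∷ h)
... | go p with p xor rightPort L v
...   | false = let w = v +ℤ Data.Integer.+ 1 in
                w , ((label L w , just (not (rightPort L w))) ∷ h)
...   | true  = let w = v -ℤ Data.Integer.+ 1 in
                w , ((label L w , just (rightPort L w)) ∷ h)

state : Line → Algorithm → ℤ → ℕ → ℤ × List Obs
state L A v₀ zero    = v₀ , ((label L v₀ , nothing) ∷ [])
state L A v₀ (suc t) = step L A (state L A v₀ t)

pos : Line → Algorithm → ℤ → ℕ → ℤ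
pos L A v₀ t = proj₁ (state L A v₀ t)

Adjacent : ℤ → ℤ → Set
Adjacent u v = (v ≡ u +ℤ Data.Integer.+ 1) ⊎ (u ≡ v +ℤ Data.Integer.+ 1)

MeetAt : Line → Algorithm → ℤ → ℤ → ℕ → Set
MeetAt L A u v t = pos L A u t ≡ pos L A v t

open import Data.Product using (∃)
SolvesAdjacentRendezvous : Algorithm → Set
SolvesAdjacentRendezvous A = ∀ (L : Line) (u v : ℤ) → Adjacent u v → ∃ λ t → MeetAt L A u v t

maxStartLabel : Line → ℤ → ℤ → ℕ
maxStartLabel L u v = label L u ⊔ label L v

module Submission where

-- A deterministic agent on a line whose port 1 always points towards +1 acts, during its first
-- T rounds, only on the 2T+1 labels around its start. Colour each (2T+1)-tuple of labels by the
-- first T actions of an agent started in its middle. If a strictly decreasing (2T+2)-tuple M has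
-- both of its (2T+1)-windows (drop the last entry / drop the first) of the same colour, then on
-- the line labelled by M the agents started at positions T and T+1 make identical moves and stay
-- at distance 1 for T rounds. Such an M with entries below N exists as soon as N exceeds a tower of
-- height 2T over the number 3^T of colours: this is the chromatic-number argument for shift
-- graphs, inducting on the length by colouring a tuple with the set of colours of its extensions
-- by a larger first entry. The start labels then lie below 2↑↑(4T+2), so T ≥ (log* ℓ − 2)/4.

open import Defs
open import Data.Nat as ℕ
  using (ℕ; zero; suc; _+_; _*_; _∸_; _^_; _≤_; _<_; _>_; _≤ᵇ_; z≤n; s≤s)
open import Data.Nat.Properties as ℕ
  using (≤-refl; ≤-trans; <⇒≤; +-mono-≤; m≤m+n; module ≤-Reasoning)
open import Data.Nat.GeneralisedArithmetic using (iterate)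
open import Data.Nat.Logarithm using (⌈log₂_⌉; ⌈log₂⌉-mono-≤; ⌈log₂2^n⌉≡n)
open import Data.Nat.Tactic.RingSolver using (solve-∀)
open import Data.Integer as ℤ using (ℤ; +_; -[1+_]; 0ℤ; 1ℤ; -1ℤ; ∣_∣)
import Data.Integer.Properties as ℤ
open import Data.Bool using (Bool; T; true; false; not)
open import Data.Empty using (⊥-elim)
open import Data.Maybe using (Maybe; just; nothing)
open import Data.Product using (∃; _×_; _,_; proj₁; proj₂)
open import Data.Sum using (inj₁)
open import Data.List using (List; []; _∷_)
open import Data.Fin as Fin using (Fin; toℕ; fromℕ<; funToFin; finToFun)
import Data.Fin.Properties as Fin
open import Data.Fin.Patterns using (0F; 1F; 2F)
open import Data.Vec using (Vec; []; _∷_; head; tail; init)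
open import Data.Vec.Relation.Unary.All using (All; []; _∷_)
open import Data.Vec.Relation.Unary.Linked as Linked using (Linked; [-]; _∷_)
open import Relation.Nullary using (¬_; Dec; yes; no; _×-dec_)
open import Relation.Binary.PropositionalEquality
  using (_≡_; refl; sym; trans; cong; cong₂; subst; module ≡-Reasoning)

private variable
  X P Q : Set
  k n r : ℕ
  z₁ z₂ : ℤ

-- Towers and log*

iterate-suc : ∀ (f : X → X) x n → iterate f x (suc n) ≡ f (iterate f x n)
iterate-suc f x zero    = refl
iterate-suc f x (suc n) = iterate-suc f (f x) n

iterate-+ : ∀ (f : X → X) x m n → iterate f (iterate f x m) n ≡ iterate f x (m + n)
iterate-+ f x zero    n = refl
iterate-+ f x (suc m) n = iterate-+ f (f x) m n

iterate-mono-≤ : ∀ {f : ℕ → ℕ} → (∀ {x y} → x ≤ y → f x ≤ f y) →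
                 ∀ {x y} n → x ≤ y → iterate f x n ≤ iterate f y n
iterate-mono-≤ f-mono zero    x≤y = x≤y
iterate-mono-≤ f-mono (suc n) x≤y = iterate-mono-≤ f-mono n (f-mono x≤y)

tower : ℕ → ℕ → ℕ
tower h x = iterate (2 ^_) x h

2↑↑_ : ℕ → ℕ
2↑↑ h = tower h 1

tower-mono-≤ : ∀ h {x y} → x ≤ y → tower h x ≤ tower h y
tower-mono-≤ h = iterate-mono-≤ (ℕ.^-monoʳ-≤ 2) h

n<2^n : ∀ n → n < 2 ^ n
n<2^n zero    = s≤s z≤n
n<2^n (suc n) = +-mono-≤ (ℕ.m^n>0 2 n) (≤-trans (n<2^n n) (m≤m+n (2 ^ n) 0))

m+m≤2^m : ∀ m → 1 ≤ m → m + m ≤ 2 ^ m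
m+m≤2^m (suc m) _ = +-mono-≤ (n<2^n m) (≤-trans (n<2^n m) (m≤m+n (2 ^ m) 0))

n≤2↑↑n : ∀ n → n ≤ 2↑↑ n
n≤2↑↑n zero    = z≤n
n≤2↑↑n (suc n) = subst (suc n ≤_) (sym (iterate-suc (2 ^_) 1 n))
                       (ℕ.≤-<-trans (n≤2↑↑n n) (n<2^n (2↑↑ n)))

logStarAux-≤ : ∀ fuel h {x} → x ≤ 2↑↑ h → logStarAux fuel x ≤ h
logStarAux-≤ zero       h       _   = z≤n
logStarAux-≤ (suc fuel) h {x} x≤ with x ≤ᵇ 1 in x≤1
... | true = z≤n
logStarAux-≤ (suc fuel) zero    x≤ | false = ⊥-elim (subst T x≤1 (ℕ.≤⇒≤ᵇ x≤))
logStarAux-≤ (suc fuel) (suc h) {x} x≤ | false = s≤s (logStarAux-≤ fuel h (begin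
  ⌈log₂ x ⌉                ≤⟨ ⌈log₂⌉-mono-≤ (subst (x ≤_) (iterate-suc (2 ^_) 1 h) x≤) ⟩
  ⌈log₂ (2 ^ 2↑↑ h) ⌉      ≡⟨ ⌈log₂2^n⌉≡n (2↑↑ h) ⟩
  2↑↑ h                    ∎))
  where open ≤-Reasoning

logStar-≤ : ∀ h {x} → x ≤ 2↑↑ h → logStar x ≤ h
logStar-≤ h {x} = logStarAux-≤ x h

3^n≤2↑↑[1+n+n] : ∀ n → 3 ^ n ≤ 2↑↑ (suc (n + n))
3^n≤2↑↑[1+n+n] n = begin
  3 ^ n                 ≤⟨ ℕ.^-monoˡ-≤ n (s≤s (s≤s (s≤s z≤n))) ⟩
  4 ^ n                 ≡⟨ ℕ.^-*-assoc 2 2 n ⟩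
  2 ^ (n + (n + 0))     ≡⟨ cong (λ m → 2 ^ (n + m)) (ℕ.+-identityʳ n) ⟩
  2 ^ (n + n)           ≤⟨ ℕ.^-monoʳ-≤ 2 (n≤2↑↑n (n + n)) ⟩
  2 ^ 2↑↑ (n + n)       ≡⟨ iterate-suc (2 ^_) 1 (n + n) ⟨
  2↑↑ (suc (n + n))     ∎
  where open ≤-Reasoning

windowLabels≤2↑↑ : ∀ T → suc T + tower (T + T) (3 ^ T) ≤ 2↑↑ (2 + 4 * T)
windowLabels≤2↑↑ T = begin
  suc T + tower (T + T) (3 ^ T)     ≤⟨ +-mono-≤ T<h (tower-mono-≤ (T + T) (3^n≤2↑↑[1+n+n] T)) ⟩
  h + tower (T + T) (2↑↑ (suc (T + T)))
                          ≡⟨ cong (λ y → h + y) (iterate-+ (2 ^_) 1 (suc (T + T)) (T + T)) ⟩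
  h + 2↑↑ h                         ≤⟨ +-mono-≤ (n≤2↑↑n h) ≤-refl ⟩
  2↑↑ h + 2↑↑ h                     ≤⟨ m+m≤2^m (2↑↑ h) (≤-trans (s≤s z≤n) (n≤2↑↑n h)) ⟩
  2 ^ 2↑↑ h                         ≡⟨ iterate-suc (2 ^_) 1 h ⟨
  2↑↑ (suc h)                       ≡⟨ cong 2↑↑_ (height T) ⟩
  2↑↑ (2 + 4 * T)                   ∎
  where
  open ≤-Reasoning
  h = suc (T + T) + (T + T)
  T<h : suc T ≤ h
  T<h = s≤s (≤-trans (m≤m+n T T) (m≤m+n (T + T) (T + T)))
  height : ∀ T → suc (suc (T + T) + (T + T)) ≡ 2 + 4 * T
  height = solve-∀

rounds≤ : ∀ {t} T → 4 * t ≤ 2 + 4 * T → t ≤ T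
rounds≤ {t} T 4t≤ = ℕ.≤-pred (ℕ.*-cancelˡ-< 4 t (suc T) (begin-strict
  4 * t         ≤⟨ 4t≤ ⟩
  2 + 4 * T     <⟨ ℕ.+-monoˡ-< (4 * T) {2} {4} (s≤s (s≤s (s≤s z≤n))) ⟩
  4 + 4 * T     ≡⟨ ℕ.*-suc 4 T ⟨
  4 * suc T     ∎))
  where open ≤-Reasoning

-- Monochromatic edges in shift graphs

indicator : Dec P → Fin 2
indicator (yes _) = 1F
indicator (no _)  = 0F

indicator-reflects : (p? : Dec P) (q? : Dec Q) → indicator p? ≡ indicator q? → P → Q
indicator-reflects _       (yes q) _  _ = q
indicator-reflects (no ¬p) (no _)  _  p = ⊥-elim (¬p p)

funToFin-injective : ∀ {m n} {f g : Fin m → Fin n} → funToFin f ≡ funToFin g → ∀ i → f i ≡ g i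
funToFin-injective {f = f} {g} eq i = begin
  f i                     ≡⟨ sym (Fin.finToFun-funToFin f i) ⟩
  finToFun (funToFin f) i ≡⟨ cong (λ x → finToFun x i) eq ⟩
  finToFun (funToFin g) i ≡⟨ Fin.finToFun-funToFin g i ⟩
  g i                     ∎
  where open ≡-Reasoning

Extension : ℕ → (Vec ℕ (2 + r) → Fin k) → Vec ℕ (suc r) → Fin k → Set
Extension N c W j = ∃ λ (b : Fin N) → head W < toℕ b × c (toℕ b ∷ W) ≡ j

extension? : ∀ N (c : Vec ℕ (2 + r) → Fin k) W j → Dec (Extension N c W j)
extension? N c W j = Fin.any? λ b → head W ℕ.<? toℕ b ×-dec c (toℕ b ∷ W) Fin.≟ j

extension-by-head : ∀ {N} (c : Vec ℕ (2 + r) → Fin k) {x W} →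
                    x < N → head W < x → Extension N c W (c (x ∷ W))
extension-by-head c {x} {W} x<N W<x =
  fromℕ< x<N ,
  subst (head W <_) (sym (Fin.toℕ-fromℕ< x<N)) W<x ,
  cong (λ y → c (y ∷ W)) (Fin.toℕ-fromℕ< x<N)

extensionColour : ℕ → (Vec ℕ (2 + r) → Fin k) → Vec ℕ (suc r) → Fin (2 ^ k)
extensionColour N c W = funToFin λ j → indicator (extension? N c W j)

shift-graph-monochromatic-edge :
  ∀ r {k N} → tower r k < N → (c : Vec ℕ (suc r) → Fin k) →
  ∃ λ (M : Vec ℕ (2 + r)) → Linked _>_ M × All (_< N) M × c (tail M) ≡ c (init M)
shift-graph-monochromatic-edge zero k<N c
  with i , j , i<j , same ← Fin.pigeonhole k<N (λ b → c (toℕ b ∷ []))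
  = toℕ j ∷ toℕ i ∷ [] , i<j ∷ [-] , Fin.toℕ<n j ∷ Fin.toℕ<n i ∷ [] , same
shift-graph-monochromatic-edge (suc r) {N = N} tower<N c
  with x ∷ W , W<x ∷ desc , x<N ∷ bounded , same
         ← shift-graph-monochromatic-edge r tower<N (extensionColour N c)
  -- c (x ∷ W) extends tail = W, so by `same` some c (b ∷ x ∷ init W) with b > x equals it.
  with b , x<b , colour-b ← indicator-reflects (extension? N c W (c (x ∷ W)))
                                               (extension? N c (x ∷ init W) (c (x ∷ W)))
                                               (funToFin-injective same (c (x ∷ W)))
                                               (extension-by-head c x<N W<x)
  = toℕ b ∷ x ∷ W , x<b ∷ W<x ∷ desc , Fin.toℕ<n b ∷ x<N ∷ bounded , sym colour-b

-- Labelling the line by a window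

lookupℤ : Vec X n → ℤ → Maybe X
lookupℤ []       _         = nothing
lookupℤ (_ ∷ _)  -[1+ _ ]  = nothing
lookupℤ (x ∷ _)  (+ zero)  = just x
lookupℤ (_ ∷ xs) (+ suc i) = lookupℤ xs (+ i)

lookupℤ-< : (xs : Vec X n) {i : ℕ} → i < n → ∃ λ x → lookupℤ xs (+ i) ≡ just x
lookupℤ-< (x ∷ _)  {zero}  _         = x , refl
lookupℤ-< (_ ∷ xs) {suc i} (s≤s i<n) = lookupℤ-< xs i<n

lookupℤ-init : (xs : Vec X (suc n)) {i : ℕ} → i < n → lookupℤ (init xs) (+ i) ≡ lookupℤ xs (+ i)
lookupℤ-init (_ ∷ _ ∷ _)  {zero}  _         = refl
lookupℤ-init (_ ∷ y ∷ ys) {suc i} (s≤s i<n) = lookupℤ-init (y ∷ ys) i<n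

All-lookupℤ : ∀ {P : X → Set} {z} {xs : Vec X n} {x} → All P xs → lookupℤ xs z ≡ just x → P x
All-lookupℤ {z = + zero}  (px ∷ _)  refl = px
All-lookupℤ {z = + suc i} (_ ∷ pxs) eq   = All-lookupℤ pxs eq

lookupℤ-tail-< : ∀ {z y x} {ys : Vec ℕ n} → Linked _>_ (y ∷ ys) → lookupℤ ys z ≡ just x → x < y
lookupℤ-tail-< {z = + zero} {ys = _ ∷ _}  (y'<y ∷ _)    refl = y'<y
lookupℤ-tail-< {z = + suc i} {ys = _ ∷ _} (y'<y ∷ desc) eq   =
  ℕ.<-trans (lookupℤ-tail-< desc eq) y'<y

lookupℤ-injective : ∀ {z₁ z₂ x} {xs : Vec ℕ n} → Linked _>_ xs →
                    lookupℤ xs z₁ ≡ just x → lookupℤ xs z₂ ≡ just x → z₁ ≡ z₂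
lookupℤ-injective {z₁ = + zero}  {+ zero}  {xs = _ ∷ _} _    _    _  = refl
lookupℤ-injective {z₁ = + zero}  {+ suc j} {xs = _ ∷ _} desc refl e₂ =
  ⊥-elim (ℕ.<-irrefl refl (lookupℤ-tail-< desc e₂))
lookupℤ-injective {z₁ = + suc i} {+ zero}  {xs = _ ∷ _} desc e₁ refl =
  ⊥-elim (ℕ.<-irrefl refl (lookupℤ-tail-< desc e₁))
lookupℤ-injective {z₁ = + suc i} {+ suc j} {xs = _ ∷ _} desc e₁ e₂ =
  cong ℤ.suc (lookupℤ-injective (Linked.tail desc) e₁ e₂)

zigzag : ℤ → ℕ
zigzag (+ n)    = 2 * n
zigzag -[1+ n ] = suc (2 * n)

zigzag-injective : zigzag z₁ ≡ zigzag z₂ → z₁ ≡ z₂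
zigzag-injective {+ m}      {+ n}      eq = cong +_ (ℕ.*-cancelˡ-≡ m n 2 eq)
zigzag-injective {+ m}      { -[1+ n ]} eq = ⊥-elim (ℕ.even≢odd m n eq)
zigzag-injective { -[1+ m ]} {+ n}      eq = ⊥-elim (ℕ.even≢odd n m (sym eq))
zigzag-injective { -[1+ m ]} { -[1+ n ]} eq =
  cong -[1+_] (ℕ.*-cancelˡ-≡ m n 2 (ℕ.suc-injective eq))

lineLabel : ℕ → ℕ → Vec ℕ n → ℤ → ℕ
lineLabel K N W z with lookupℤ W z
... | just x  = K + x
... | nothing = K + N + zigzag z

lineLabel-window : ∀ K N (W : Vec ℕ n) z {x} → lookupℤ W z ≡ just x → lineLabel K N W z ≡ K + x
lineLabel-window K N W z eq with lookupℤ W z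
lineLabel-window K N W z refl | just x = refl

lineLabel-≥ : ∀ K N (W : Vec ℕ n) z → K ≤ lineLabel K N W z
lineLabel-≥ K N W z with lookupℤ W z
... | just x  = m≤m+n K x
... | nothing = ≤-trans (m≤m+n K N) (m≤m+n (K + N) (zigzag z))

lineLabel-< : ∀ K N (W : Vec ℕ n) {i} → All (_< N) W → i < n → lineLabel K N W (+ i) < K + N
lineLabel-< K N W {i} bounded i<n with x , eq ← lookupℤ-< W i<n =
  subst (_< K + N) (sym (lineLabel-window K N W (+ i) eq))
        (ℕ.+-monoʳ-< K (All-lookupℤ bounded eq))

window<outside : ∀ K {N x} e → x < N → K + x < K + N + e
window<outside K e x<N = ℕ.<-≤-trans (ℕ.+-monoʳ-< K x<N) (m≤m+n _ e)

lineLabel-injective : ∀ K N {W : Vec ℕ n} {z₁ z₂} → Linked _>_ W → All (_< N) W →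
                      lineLabel K N W z₁ ≡ lineLabel K N W z₂ → z₁ ≡ z₂
lineLabel-injective K N {W} {z₁} {z₂} desc bounded eq
  with lookupℤ W z₁ in e₁ | lookupℤ W z₂ in e₂
... | just x  | just y  with refl ← ℕ.+-cancelˡ-≡ K x y eq = lookupℤ-injective desc e₁ e₂
... | just x  | nothing = ⊥-elim (ℕ.<⇒≢ (window<outside K _ (All-lookupℤ bounded e₁)) eq)
... | nothing | just y  = ⊥-elim (ℕ.<⇒≢ (window<outside K _ (All-lookupℤ bounded e₂)) (sym eq))
... | nothing | nothing = zigzag-injective (ℕ.+-cancelˡ-≡ (K + N) _ _ eq)

windowLine : ∀ K N → 1 ≤ K → (W : Vec ℕ n) → Linked _>_ W → All (_< N) W → Line
windowLine K N 1≤K W desc bounded = record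
  { label     = lineLabel K N W
  ; label-pos = λ z → ≤-trans 1≤K (lineLabel-≥ K N W z)
  ; label-inj = λ _ _ → lineLabel-injective K N desc bounded
  ; rightPort = λ _ → true
  }

lineLabel-init : ∀ K N (M : Vec ℕ (suc n)) {i} → i < n →
                 lineLabel K N M (+ i) ≡ lineLabel K N (init M) (+ i)
lineLabel-init K N M i<n with x , eq ← lookupℤ-< (init M) i<n =
  trans (lineLabel-window K N M _ (trans (sym (lookupℤ-init M i<n)) eq))
        (sym (lineLabel-window K N (init M) _ eq))

lineLabel-tail : ∀ K N (M : Vec ℕ (suc n)) {i} → i < n →
                 lineLabel K N M (+ suc i) ≡ lineLabel K N (tail M) (+ i)
lineLabel-tail K N M@(_ ∷ W) {i} i<n with x , eq ← lookupℤ-< W i<n =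
  trans (lineLabel-window K N M (+ suc i) eq) (sym (lineLabel-window K N W (+ i) eq))

-- Runs on a line whose port 1 always leads towards +1

displacement : Action → ℤ
displacement idle       = 0ℤ
displacement (go false) = -1ℤ
displacement (go true)  = 1ℤ

∣displacement∣≤1 : ∀ a → ∣ displacement a ∣ ≤ 1
∣displacement∣≤1 idle       = z≤n
∣displacement∣≤1 (go false) = ≤-refl
∣displacement∣≤1 (go true)  = ≤-refl

arrivalPort : Action → Maybe Bool
arrivalPort idle   = nothing
arrivalPort (go p) = just (not p)

-- Unlike `step`, this takes an arbitrary labelling: the windows that serve as colours are not
-- injectively labelled, so they do not form a `Line`.
runStep : (ℤ → ℕ) → Algorithm → ℤ × List Obs → ℤ × List Obs
runStep lab A (v , h) =
  let w = v ℤ.+ displacement (A h) in w , (lab w , arrivalPort (A h)) ∷ h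

run : (ℤ → ℕ) → Algorithm → ℤ → ℕ → ℤ × List Obs
run lab A v zero    = v , (lab v , nothing) ∷ []
run lab A v (suc t) = runStep lab A (run lab A v t)

position : (ℤ → ℕ) → Algorithm → ℤ → ℕ → ℤ
position lab A v t = proj₁ (run lab A v t)

history : (ℤ → ℕ) → Algorithm → ℤ → ℕ → List Obs
history lab A v t = proj₂ (run lab A v t)

step≡runStep : ∀ L A → (∀ v → rightPort L v ≡ true) → ∀ s → step L A s ≡ runStep (label L) A s
step≡runStep L A right (v , h) with A h
... | idle     = cong (λ w → w , (label L w , nothing) ∷ h) (sym (ℤ.+-identityʳ v))
... | go false rewrite right v | right (v ℤ.+ -1ℤ) = refl
... | go true  rewrite right v | right (v ℤ.+ 1ℤ)  = refl

state≡run : ∀ L A → (∀ v → rightPort L v ≡ true) → ∀ v t → state L A v t ≡ run (label L) A v t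
state≡run L A right v zero    = refl
state≡run L A right v (suc t) =
  trans (cong (step L A) (state≡run L A right v t)) (step≡runStep L A right _)

Agree : (ℤ → ℕ) → ℤ → (ℤ → ℕ) → ℤ → ℕ → Set
Agree lab₁ v₁ lab₂ v₂ T = ∀ d → ∣ d ∣ ≤ T → lab₁ (v₁ ℤ.+ d) ≡ lab₂ (v₂ ℤ.+ d)

InLockstep : ℤ → ℤ → ℕ → ℤ × List Obs → ℤ × List Obs → Set
InLockstep v₁ v₂ t (p₁ , h₁) (p₂ , h₂) =
  ∃ λ d → ∣ d ∣ ≤ t × p₁ ≡ v₁ ℤ.+ d × p₂ ≡ v₂ ℤ.+ d × h₁ ≡ h₂

∣d+displacement∣≤1+ : ∀ {t} d a → ∣ d ∣ ≤ t → ∣ d ℤ.+ displacement a ∣ ≤ suc t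
∣d+displacement∣≤1+ {t} d a ∣d∣≤t = begin
  ∣ d ℤ.+ displacement a ∣          ≡⟨ cong ∣_∣ (ℤ.+-comm d (displacement a)) ⟩
  ∣ displacement a ℤ.+ d ∣          ≤⟨ ℤ.∣i+j∣≤∣i∣+∣j∣ (displacement a) d ⟩
  ∣ displacement a ∣ + ∣ d ∣        ≤⟨ +-mono-≤ (∣displacement∣≤1 a) ∣d∣≤t ⟩
  suc t                             ∎
  where open ≤-Reasoning

module _ {lab₁ lab₂ : ℤ → ℕ} {v₁ v₂ : ℤ} {T : ℕ} (agree : Agree lab₁ v₁ lab₂ v₂ T)
         (A : Algorithm) where

  runStep-lockstep : ∀ {t} → suc t ≤ T → ∀ d h → ∣ d ∣ ≤ t →
    InLockstep v₁ v₂ (suc t) (runStep lab₁ A (v₁ ℤ.+ d , h)) (runStep lab₂ A (v₂ ℤ.+ d , h))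
  runStep-lockstep t<T d h ∣d∣≤t =
    d ℤ.+ δ , ∣d+δ∣≤1+t , ℤ.+-assoc v₁ d δ , ℤ.+-assoc v₂ d δ ,
    cong (λ ℓ → (ℓ , arrivalPort (A h)) ∷ h) (begin
      lab₁ (v₁ ℤ.+ d ℤ.+ δ)   ≡⟨ cong lab₁ (ℤ.+-assoc v₁ d δ) ⟩
      lab₁ (v₁ ℤ.+ (d ℤ.+ δ)) ≡⟨ agree (d ℤ.+ δ) (≤-trans ∣d+δ∣≤1+t t<T) ⟩
      lab₂ (v₂ ℤ.+ (d ℤ.+ δ)) ≡⟨ cong lab₂ (ℤ.+-assoc v₂ d δ) ⟨
      lab₂ (v₂ ℤ.+ d ℤ.+ δ)   ∎)
    where
    open ≡-Reasoning
    δ = displacement (A h)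
    ∣d+δ∣≤1+t = ∣d+displacement∣≤1+ d (A h) ∣d∣≤t

  run-lockstep : ∀ {t} → t ≤ T → InLockstep v₁ v₂ t (run lab₁ A v₁ t) (run lab₂ A v₂ t)
  run-lockstep {zero} _ =
    0ℤ , z≤n , sym (ℤ.+-identityʳ v₁) , sym (ℤ.+-identityʳ v₂) ,
    cong (λ ℓ → (ℓ , nothing) ∷ []) (begin
      lab₁ v₁           ≡⟨ cong lab₁ (ℤ.+-identityʳ v₁) ⟨
      lab₁ (v₁ ℤ.+ 0ℤ)  ≡⟨ agree 0ℤ z≤n ⟩
      lab₂ (v₂ ℤ.+ 0ℤ)  ≡⟨ cong lab₂ (ℤ.+-identityʳ v₂) ⟩
      lab₂ v₂           ∎)
    where open ≡-Reasoning
  run-lockstep {suc t} t<T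
    with run lab₁ A v₁ t | run lab₂ A v₂ t | run-lockstep {t} (<⇒≤ t<T)
  ... | _ , h | _ , .h | d , ∣d∣≤t , refl , refl , refl = runStep-lockstep t<T d h ∣d∣≤t

  history-local : ∀ {t} → t ≤ T → history lab₁ A v₁ t ≡ history lab₂ A v₂ t
  history-local t≤T with run-lockstep t≤T
  ... | _ , _ , _ , _ , same = same

position-offset : ∀ {lab₁ lab₂ : ℤ → ℕ} {v₁ v₂} A δ → v₂ ≡ δ ℤ.+ v₁ → ∀ t →
  (∀ s → s < t → A (history lab₁ A v₁ s) ≡ A (history lab₂ A v₂ s)) →
  position lab₂ A v₂ t ≡ δ ℤ.+ position lab₁ A v₁ t
position-offset A δ start zero    _    = start
position-offset {lab₁} {lab₂} {v₁} {v₂} A δ start (suc t) same = begin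
  position lab₂ A v₂ t ℤ.+ displacement (A (history lab₂ A v₂ t))
    ≡⟨ cong₂ ℤ._+_ (position-offset A δ start t λ s s<t → same s (ℕ.m<n⇒m<1+n s<t))
                   (cong displacement (sym (same t ≤-refl))) ⟩
  δ ℤ.+ position lab₁ A v₁ t ℤ.+ displacement (A (history lab₁ A v₁ t))
    ≡⟨ ℤ.+-assoc δ _ _ ⟩
  δ ℤ.+ (position lab₁ A v₁ t ℤ.+ displacement (A (history lab₁ A v₁ t))) ∎
  where open ≡-Reasoning

-- The hard instance

ball-in-window : ∀ T d → ∣ d ∣ ≤ T → ∃ λ i → i < suc (T + T) × + T ℤ.+ d ≡ + i
ball-in-window T (+ k)    k≤T = T + k , s≤s (ℕ.+-monoʳ-≤ T k≤T) , refl
ball-in-window T -[1+ k ] k<T =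
  T ∸ suc k , s≤s (≤-trans (ℕ.m∸n≤m T (suc k)) (m≤m+n T T)) , ℤ.⊖-≥ k<T

agree-init : ∀ K N T (M : Vec ℕ (2 + (T + T))) →
             Agree (lineLabel K N M) (+ T) (lineLabel K N (init M)) (+ T) T
agree-init K N T M d ∣d∣≤T with i , i<n , eq ← ball-in-window T d ∣d∣≤T
  rewrite eq = lineLabel-init K N M i<n

agree-tail : ∀ K N T (M : Vec ℕ (2 + (T + T))) →
             Agree (lineLabel K N M) (+ suc T) (lineLabel K N (tail M)) (+ T) T
agree-tail K N T M d ∣d∣≤T with i , i<n , eq ← ball-in-window T d ∣d∣≤T = begin
  lineLabel K N M (+ suc T ℤ.+ d)           ≡⟨ cong (lineLabel K N M) (ℤ.+-assoc 1ℤ (+ T) d) ⟩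
  lineLabel K N M (1ℤ ℤ.+ (+ T ℤ.+ d))      ≡⟨ cong (λ z → lineLabel K N M (1ℤ ℤ.+ z)) eq ⟩
  lineLabel K N M (+ suc i)                 ≡⟨ lineLabel-tail K N M i<n ⟩
  lineLabel K N (tail M) (+ i)              ≡⟨ cong (lineLabel K N (tail M)) eq ⟨
  lineLabel K N (tail M) (+ T ℤ.+ d)        ∎
  where open ≡-Reasoning

actionCode : Action → Fin 3
actionCode idle       = 0F
actionCode (go false) = 1F
actionCode (go true)  = 2F

actionCode-injective : ∀ {a b} → actionCode a ≡ actionCode b → a ≡ b
actionCode-injective {idle}     {idle}     _  = refl
actionCode-injective {idle}     {go false} ()
actionCode-injective {idle}     {go true}  ()
actionCode-injective {go false} {idle}     ()
actionCode-injective {go true}  {idle}     ()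
actionCode-injective {go false} {go false} _  = refl
actionCode-injective {go false} {go true}  ()
actionCode-injective {go true}  {go false} ()
actionCode-injective {go true}  {go true}  _  = refl

module HardInstance (A : Algorithm) (T : ℕ) where

  N : ℕ
  N = suc (tower (T + T) (3 ^ T))

  lab : Vec ℕ n → ℤ → ℕ
  lab = lineLabel (suc T) N

  actions : Vec ℕ (suc (T + T)) → Fin T → Fin 3
  actions W s = actionCode (A (history (lab W) A (+ T) (toℕ s)))

  colour : Vec ℕ (suc (T + T)) → Fin (3 ^ T)
  colour W = funToFin (actions W)

  colour-actions : ∀ W₁ W₂ → colour W₁ ≡ colour W₂ → ∀ s → s < T →
                   A (history (lab W₁) A (+ T) s) ≡ A (history (lab W₂) A (+ T) s)
  colour-actions W₁ W₂ same s s<T =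
    subst (λ s → A (history (lab W₁) A (+ T) s) ≡ A (history (lab W₂) A (+ T) s))
          (Fin.toℕ-fromℕ< s<T)
          (actionCode-injective (funToFin-injective {f = actions W₁} same (fromℕ< s<T)))

  instance-from-edge :
    (M : Vec ℕ (2 + (T + T))) → Linked _>_ M → All (_< N) M → colour (tail M) ≡ colour (init M) →
    ∃ λ (L : Line) → ∃ λ u → ∃ λ v → Adjacent u v ×
      suc T ≤ maxStartLabel L u v × maxStartLabel L u v ≤ 2↑↑ (2 + 4 * T) ×
      ((t : ℕ) → t ≤ T → ¬ MeetAt L A u v t)
  instance-from-edge M desc bounded same =
    L , + T , + suc T , inj₁ (ℤ.+-comm 1ℤ (+ T)) ,
    ≤-trans (lineLabel-≥ (suc T) N M (+ T)) (ℕ.m≤m⊔n _ _) ,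
    ≤-trans (ℕ.⊔-lub (start-label T (s≤s (ℕ.m≤n⇒m≤1+n (m≤m+n T T))))
                     (start-label (suc T) (s≤s (s≤s (m≤m+n T T)))))
            (windowLabels≤2↑↑ T) ,
    apart
    where
    L = windowLine (suc T) N (s≤s z≤n) M desc bounded

    start-label : ∀ i → i < 2 + (T + T) → lab M (+ i) ≤ suc T + tower (T + T) (3 ^ T)
    start-label i i<n = ℕ.≤-pred (subst (lab M (+ i) <_) (ℕ.+-suc (suc T) _)
                                         (lineLabel-< (suc T) N M bounded i<n))

    same-actions : ∀ s → s < T → A (history (lab M) A (+ T) s) ≡ A (history (lab M) A (+ suc T) s)
    same-actions s s<T = begin
      A (history (lab M) A (+ T) s)
        ≡⟨ cong A (history-local (agree-init _ _ T M) A (<⇒≤ s<T)) ⟩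
      A (history (lab (init M)) A (+ T) s)
        ≡⟨ colour-actions (tail M) (init M) same s s<T ⟨
      A (history (lab (tail M)) A (+ T) s)
        ≡⟨ cong A (history-local (agree-tail _ _ T M) A (<⇒≤ s<T)) ⟨
      A (history (lab M) A (+ suc T) s)
        ∎
      where open ≡-Reasoning

    apart : (t : ℕ) → t ≤ T → ¬ MeetAt L A (+ T) (+ suc T) t
    apart t t≤T meet = ℤ.i≢suc[i] (begin
      position (lab M) A (+ T) t      ≡⟨ cong proj₁ (state≡run L A (λ _ → refl) (+ T) t) ⟨
      pos L A (+ T) t                 ≡⟨ meet ⟩
      pos L A (+ suc T) t             ≡⟨ cong proj₁ (state≡run L A (λ _ → refl) (+ suc T) t) ⟩
      position (lab M) A (+ suc T) t  ≡⟨ position-offset A 1ℤ refl t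
                                           (λ s s<t → same-actions s (ℕ.<-≤-trans s<t t≤T)) ⟩
      ℤ.suc (position (lab M) A (+ T) t) ∎)
      where open ≡-Reasoning

  missed-meeting :
    ∃ λ (L : Line) → ∃ λ u → ∃ λ v → Adjacent u v ×
      suc T ≤ maxStartLabel L u v × maxStartLabel L u v ≤ 2↑↑ (2 + 4 * T) ×
      ((t : ℕ) → t ≤ T → ¬ MeetAt L A u v t)
  missed-meeting
    with M , desc , bounded , same ← shift-graph-monochromatic-edge (T + T) ≤-refl colour
    = instance-from-edge M desc bounded same

mainTheorem3 : ∃ λ (p : ℕ) → ∃ λ (q : ℕ) → 0 < p × 0 < q ×
                 ((A : Algorithm) → SolvesAdjacentRendezvous A → (L₀ : ℕ) →
                  ∃ λ (L : Line) → ∃ λ (u : ℤ) → ∃ λ (v : ℤ) →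
                    Adjacent u v × L₀ ≤ maxStartLabel L u v ×
                    ((t : ℕ) → q * t ≤ p * logStar (maxStartLabel L u v) →
                      ¬ MeetAt L A u v t))
mainTheorem3 = 1 , 4 , s≤s z≤n , s≤s z≤n , λ A _ L₀ → hard-instance A L₀
  where
  hard-instance : ∀ A L₀ →
    ∃ λ (L : Line) → ∃ λ u → ∃ λ v → Adjacent u v × L₀ ≤ maxStartLabel L u v ×
      ((t : ℕ) → 4 * t ≤ 1 * logStar (maxStartLabel L u v) → ¬ MeetAt L A u v t)
  hard-instance A L₀
    with L , u , v , adjacent , lower , upper , apart ← HardInstance.missed-meeting A L₀ =
    L , u , v , adjacent , ≤-trans (ℕ.n≤1+n L₀) lower ,
    λ t 4t≤ → apart t (rounds≤ L₀ (begin
      4 * t                                ≤⟨ 4t≤ ⟩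
      1 * logStar (maxStartLabel L u v)    ≡⟨ ℕ.*-identityˡ _ ⟩
      logStar (maxStartLabel L u v)        ≤⟨ logStar-≤ (2 + 4 * L₀) upper ⟩
      2 + 4 * L₀                           ∎))
    where open ≤-Reasoning
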